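{- Let $G$ be a finite nilpotent group and $H$ a subgroup of $G$. Then there is a subnormal series $H = H_1 \triangleleft H_2 \triangleleft \cdots \triangleleft H_m = H^G$ of $H^G$ such that for each $1\le k<m$: (i) $H_{k+1}/H_k$ is generated by (the image of) some $G$-conjugate $g^{ -1}Hg$ of $H$, and (ii) $H_{k+1}/H_k$ has prime-power order.
   Context: $H^G = \langle g^{ -1}hg \mid h\in H,\ g\in G\rangle$ denotes the normal closure of $H$ in $G$. -}

module Defs where

open import Data.Nat using (ℕ; zero; suc; _*_; _^_)
open import Data.Fin using (Fin)
open import Data.Fin.Subset using (Subset; _∈_; _⊆_; ∣_∣)
open import Data.Product using (_×_; ∃; ∃₂)
open import Data.Sum using (_⊎_)
open import Data.Nat.Primality using (Prime)
open import Algebra.Structures using (IsGroup)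
open import Relation.Binary.PropositionalEquality using (_≡_)

record FinGroup (n : ℕ) : Set where
  infixl 7 _∙_
  infix 8 _⁻¹
  field
    _∙_     : Fin n → Fin n → Fin n
    ε       : Fin n
    _⁻¹     : Fin n → Fin n
    isGroup : IsGroup _≡_ _∙_ ε _⁻¹

module _ {n : ℕ} (G : FinGroup n) where
  open FinGroup G

  IsSubgroup : Subset n → Set
  IsSubgroup K = (ε ∈ K)
               × (∀ {x y} → x ∈ K → y ∈ K → (x ∙ y) ∈ K)
               × (∀ {x} → x ∈ K → (x ⁻¹) ∈ K)

  conj : Fin n → Fin n → Fin n
  conj g h = g ⁻¹ ∙ h ∙ g

  NormalIn : Subset n → Subset n → Set
  NormalIn K L = IsSubgroup K × IsSubgroup L × K ⊆ L
               × (∀ {g k} → g ∈ L → k ∈ K → conj g k ∈ K)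

  Generates : (Fin n → Set) → Subset n → Set
  Generates P K = IsSubgroup K × (∀ {x} → P x → x ∈ K)
                × (∀ L → IsSubgroup L → (∀ {x} → P x → x ∈ L) → K ⊆ L)

  ConjugateBy : Subset n → Fin n → Fin n → Set
  ConjugateBy H g x = ∃ λ h → h ∈ H × x ≡ conj g h

  AllConjugates : Subset n → Fin n → Set
  AllConjugates H x = ∃₂ λ g h → h ∈ H × x ≡ conj g h

  IsNormalClosure : Subset n → Subset n → Set
  IsNormalClosure H N = Generates (AllConjugates H) N

  commutator : Fin n → Fin n → Fin n
  commutator x y = x ⁻¹ ∙ y ⁻¹ ∙ x ∙ y

  UpperCentral : ℕ → Fin n → Set
  UpperCentral zero    x = x ≡ ε
  UpperCentral (suc i) x = ∀ g → UpperCentral i (commutator x g)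

  Nilpotent : Set
  Nilpotent = ∃ λ c → ∀ x → UpperCentral c x

  -- (for K ◁ L) L/K is generated by the image of g⁻¹Hg,
  -- i.e. L is generated by K ∪ g⁻¹Hg (correspondence theorem)
  QuotientGeneratedByConjugate : Subset n → Subset n → Subset n → Fin n → Set
  QuotientGeneratedByConjugate H K L g =
    Generates (λ x → x ∈ K ⊎ ConjugateBy H g x) L

  -- (for K ≤ L) |L/K| = |L| / |K| is a prime power
  QuotientPrimePowerOrder : Subset n → Subset n → Set
  QuotientPrimePowerOrder K L = ∃₂ λ p e → Prime p × ∣ L ∣ ≡ p ^ e * ∣ K ∣

module Submission where

-- Grow K from H to the normal closure H^G one conjugate at a time. While K is not normal,
-- the normaliser condition of the nilpotent group G gives an element g of prime-power order
-- in N(N(K)) ∖ N(K); possibly after multiplying g by an earlier conjugator of the same prime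
-- (conjugators of other primes commute with g), this yields a q-element z such that every hᶻ,
-- h ∈ H, normalises K and Hᶻ ⊈ K. Then K ◁ K Hᶻ, the quotient is generated by the image of
-- Hᶻ, and since hᶻ ≡ [h , z] modulo K it is generated by q-elements, so its order is a power
-- of q. Each K is generated by H and finitely many conjugates, so the normal K reached when
-- the process stops is H^G.

open import Defs
open import Level using (0ℓ)
open import Function using (_∘_; id)
open import Data.Empty using (⊥-elim)
open import Data.Product using (∃; ∃₂; _×_; _,_; proj₁)
open import Data.Sum using (_⊎_; inj₁; inj₂; [_,_]′)
open import Data.Bool using (Bool; true; false; not; if_then_else_)
import Data.Bool.Properties as Bool
open import Data.Nat
  using (ℕ; zero; suc; z≤n; s≤s; z<s; _<_; _≤_; _<?_; _+_; _*_; _^_; _∸_; NonZero; nonTrivial⇒n>1; >-nonZero; ≢-nonZero)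
import Data.Nat as ℕ
open import Data.Nat.Properties
  using (+-identityʳ; +-suc; +-comm; *-comm; *-assoc; *-zeroʳ; *-suc; ^-distribˡ-+-*; m^n>0;
         ≤-refl; ≤-trans; ≤-antisym; <-trans; <-irrefl; ≤-<-trans; <-≤-trans; <⇒≤; ≤-pred; ≮⇒≥; >⇒≢; n<1+n;
         m<n⇒m<1+n; n≢0⇒n>0; m<m*n; m≤m*n; m∸n≤m; m<n⇒0<n∸m; m+[n∸m]≡n; ∸-monoʳ-<;
         +-0-commutativeMonoid; module ≤-Reasoning)
open import Data.Nat.Divisibility using (_∣_; _∤_; divides; _∣?_; ∣-trans; ∣1⇒≡1; m∣m*n)
open import Data.Nat.Coprimality using (Coprime; coprime-divisor; coprime-Bézout; prime⇒coprime)
import Data.Nat.Coprimality as Coprime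
open import Data.Nat.GCD using (module Bézout)
open import Data.Nat.Primality using (Prime; prime⇒irreducible; prime⇒nonTrivial; prime⇒nonZero)
import Data.Nat.Primality.Factorisation as Factorisation
open import Data.Nat.Induction using (<-rec; <-wellFounded)
import Algebra.Properties.CommutativeMonoid.Sum +-0-commutativeMonoid as ∑
open import Data.Fin using (Fin; toℕ; fromℕ<; _≟_)
import Data.Fin.Properties as Fin
open import Data.Fin.Subset using (Subset; _∈_; _∉_; _⊆_; ∣_∣; ⊤)
open import Data.Fin.Subset.Properties using (_∈?_; ∣p∣≤n; ∈⊤; p⊂q⇒∣p∣<∣q∣; p⊆q⇒∣p∣≤∣q∣)
open import Data.Fin.Permutation using (Permutation′; _⟨$⟩ʳ_; permutation)
open import Data.Vec using (Vec; []; _∷_)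
import Data.Vec as Vec
import Data.Vec.Properties as Vec
open import Data.List using (List; []; _∷_)
open import Data.List.Relation.Unary.All using (All; []; _∷_)
import Data.List.Relation.Unary.All as All
import Data.List.Relation.Unary.Any as Any
open import Data.List.Relation.Unary.All.Properties using (¬All⇒Any¬)
open import Relation.Unary using (Pred; Decidable)
open import Relation.Nullary using (¬_; Dec; yes; no; does; contradiction)
open import Relation.Nullary.Decidable using (dec-true; _→-dec_; _×-dec_; ¬?; decidable-stable)
import Relation.Nullary.Decidable as Dec
open import Relation.Binary.PropositionalEquality using (_≡_; _≢_; refl; sym; trans; cong; cong₂; subst; module ≡-Reasoning)
open import Induction.WellFounded using (WellFounded)
import Induction.WellFounded as WF
import Relation.Binary.Construct.On as On
open import Algebra.Bundles using (Group)
open import Algebra.Structures using (IsGroup)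
import Algebra.Properties.Group as GroupProperties

prime>1 : ∀ {p} → Prime p → 1 < p
prime>1 {p} pr = nonTrivial⇒n>1 p {{prime⇒nonTrivial pr}}

coprime-* : ∀ {m a b} → Coprime m a → Coprime m b → Coprime m (a * b)
coprime-* {m} {a} m⊥a m⊥b {d} (d∣m , d∣ab) = m⊥b (d∣m , coprime-divisor d⊥a d∣ab)
  where
  d⊥a : Coprime d a
  d⊥a (e∣d , e∣a) = m⊥a (∣-trans e∣d d∣m , e∣a)

coprime-^ : ∀ {m p} b → Coprime m p → Coprime m (p ^ b)
coprime-^ zero    _   (_ , d∣1) = ∣1⇒≡1 d∣1
coprime-^ (suc b) m⊥p = coprime-* m⊥p (coprime-^ b m⊥p)

∤⇒coprime : ∀ {p m} → Prime p → p ∤ m → Coprime m p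
∤⇒coprime pr p∤m (d∣m , d∣p) with prime⇒irreducible pr d∣p
... | inj₁ d≡1  = d≡1
... | inj₂ refl = contradiction d∣m p∤m

≢⇒coprime : ∀ {p q} → Prime p → Prime q → p ≢ q → Coprime q p
≢⇒coprime {p} {q} pp pq p≢q = ∤⇒coprime pp p∤q
  where
  p∤q : p ∤ q
  p∤q p∣q with prime⇒irreducible pq p∣q
  ... | inj₁ refl = <-irrefl refl (prime>1 pp)
  ... | inj₂ p≡q  = p≢q p≡q

n<m^n : ∀ {m} → 1 < m → ∀ n → n < m ^ n
n<m^n 1<m zero    = s≤s z≤n
n<m^n {m} 1<m (suc n) = begin-strict
  suc n          ≤⟨ n<m^n 1<m n ⟩
  m ^ n          <⟨ m<m*n (m ^ n) m {{>-nonZero (≤-<-trans z≤n (n<m^n 1<m n))}} 1<m ⟩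
  m ^ n * m      ≡⟨ *-comm (m ^ n) m ⟩
  m ^ suc n      ∎
  where open ≤-Reasoning

prime-part : ∀ {p} → Prime p → ∀ k → 0 < k → ∃₂ λ b m → k ≡ p ^ b * m × p ∤ m
prime-part {p} pr = <-rec _ go
  where
  go : ∀ k → (∀ {j} → j < k → 0 < j → ∃₂ λ b m → j ≡ p ^ b * m × p ∤ m) →
       0 < k → ∃₂ λ b m → k ≡ p ^ b * m × p ∤ m
  go k rec 0<k with p ∣? k
  ... | no p∤k = 0 , k , sym (+-identityʳ k) , p∤k
  ... | yes (divides j refl) with rec j<k 0<j
    where
    0<j : 0 < j
    0<j = n≢0⇒n>0 λ { refl → <-irrefl refl 0<k }
    j<k : j < j * p
    j<k = m<m*n j p {{>-nonZero 0<j}} (prime>1 pr)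
  ... | b , m , refl , p∤m = suc b , m , *-comm-assoc , p∤m
    where
    *-comm-assoc : p ^ b * m * p ≡ p ^ suc b * m
    *-comm-assoc = trans (*-comm (p ^ b * m) p) (sym (*-assoc p (p ^ b) m))

prime-divisor : ∀ k → 1 < k → ∃ λ p → Prime p × p ∣ k
prime-divisor (suc k) 1<k with Factorisation.factorise (suc k)
... | record { factors = [] ; isFactorisation = k≡1 } = contradiction k≡1 (>⇒≢ 1<k)
... | record { factors = p ∷ _ ; isFactorisation = k≡p*ps ; factorsPrime = pr ∷ _ } =
      p , pr , subst (p ∣_) (sym k≡p*ps) (m∣m*n _)

crossing : {P : ℕ → Set} → Decidable P → ¬ P 0 → ∀ N → P N → ∃ λ b → ¬ P b × P (suc b)
crossing P? ¬P₀ zero P₀ = contradiction P₀ ¬P₀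
crossing P? ¬P₀ (suc N) Pₙ₊₁ with P? N
... | yes Pₙ = crossing P? ¬P₀ N Pₙ
... | no ¬Pₙ = N , ¬Pₙ , Pₙ₊₁

module _ {n : ℕ} where
  opaque
    toSubset : {P : Pred (Fin n) 0ℓ} → Decidable P → Subset n
    toSubset P? = Vec.tabulate (does ∘ P?)

    toSubset⁺ : {P : Pred (Fin n) 0ℓ} (P? : Decidable P) → ∀ {x} → P x → x ∈ toSubset P?
    toSubset⁺ P? {x} px = Vec.lookup⇒[]= x _ (trans (Vec.lookup∘tabulate (does ∘ P?) x) (dec-true (P? x) px))

    toSubset⁻ : {P : Pred (Fin n) 0ℓ} (P? : Decidable P) → ∀ {x} → x ∈ toSubset P? → P x
    toSubset⁻ P? {x} x∈ = witness (P? x) (trans (sym (Vec.lookup∘tabulate (does ∘ P?) x)) (Vec.[]=⇒lookup x∈))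
      where
      witness : ∀ {A : Set} (A? : Dec A) → does A? ≡ true → A
      witness (yes a) _ = a
      witness (no _) ()

  larger-rec : ∀ {ℓ} (P : Subset n → Set ℓ) → (∀ K → (∀ {K′} → ∣ K ∣ < ∣ K′ ∣ → P K′) → P K) → ∀ K → P K
  larger-rec {ℓ} P step = WF.All.wfRec ⊏-wellFounded ℓ P λ K rec → step K rec
    where
    _⊏_ : Subset n → Subset n → Set
    K′ ⊏ K = ∣ K ∣ < ∣ K′ ∣
    ⊏-wellFounded : WellFounded _⊏_
    ⊏-wellFounded = WF.Subrelation.wellFounded (λ {K′} lt → ∸-monoʳ-< lt (∣p∣≤n K′))
                      (On.wellFounded (λ K → n ∸ ∣ K ∣) <-wellFounded)

  private
    𝟙 : ∀ {m} → Subset m → Fin m → ℕ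
    𝟙 S i = if Vec.lookup S i then 1 else 0

    ∣∣≡∑𝟙 : ∀ {m} (S : Subset m) → ∣ S ∣ ≡ ∑.sum (𝟙 S)
    ∣∣≡∑𝟙 Vec.[] = refl
    ∣∣≡∑𝟙 (true Vec.∷ S) = cong suc (∣∣≡∑𝟙 S)
    ∣∣≡∑𝟙 (false Vec.∷ S) = ∣∣≡∑𝟙 S

    𝟙-∈ : ∀ {S : Subset n} {z} → z ∈ S → 𝟙 S z ≡ 1
    𝟙-∈ z∈S = cong (if_then 1 else 0) (Vec.[]=⇒lookup z∈S)

    𝟙-∉ : ∀ {S : Subset n} {z} → z ∉ S → 𝟙 S z ≡ 0
    𝟙-∉ {S} {z} z∉S with Vec.lookup S z in eq
    ... | true = contradiction (Vec.lookup⇒[]= z S eq) z∉S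
    ... | false = refl

  ∣∅∣ : ∀ (A : Subset n) → (∀ z → z ∉ A) → ∣ A ∣ ≡ 0
  ∣∅∣ A empty = begin
    ∣ A ∣                 ≡⟨ ∣∣≡∑𝟙 A ⟩
    ∑.sum (𝟙 A)           ≡⟨ ∑.sum-cong-≗ (λ z → 𝟙-∉ (empty z)) ⟩
    ∑.sum {n} (λ _ → 0)   ≡⟨ ∑.sum-replicate-zero n ⟩
    0                     ∎
    where open ≡-Reasoning

  ∣⊎∣ : ∀ (A B C : Subset n) → (∀ {z} → z ∈ A → z ∈ B ⊎ z ∈ C) → B ⊆ A → C ⊆ A →
        (∀ {z} → z ∈ B → z ∉ C) → ∣ A ∣ ≡ ∣ B ∣ + ∣ C ∣
  ∣⊎∣ A B C split B⊆A C⊆A disjoint = begin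
    ∣ A ∣                        ≡⟨ ∣∣≡∑𝟙 A ⟩
    ∑.sum (𝟙 A)                  ≡⟨ ∑.sum-cong-≗ 𝟙-split ⟩
    ∑.sum (λ z → 𝟙 B z + 𝟙 C z)  ≡⟨ ∑.∑-distrib-+ (𝟙 B) (𝟙 C) ⟩
    ∑.sum (𝟙 B) + ∑.sum (𝟙 C)    ≡⟨ cong₂ _+_ (∣∣≡∑𝟙 B) (∣∣≡∑𝟙 C) ⟨
    ∣ B ∣ + ∣ C ∣                ∎
    where
    open ≡-Reasoning
    𝟙-split : ∀ z → 𝟙 A z ≡ 𝟙 B z + 𝟙 C z
    𝟙-split z with z ∈? B | z ∈? C
    ... | yes z∈B | yes z∈C = contradiction z∈C (disjoint z∈B)
    ... | yes z∈B | no z∉C  = trans (𝟙-∈ (B⊆A z∈B)) (sym (cong₂ _+_ (𝟙-∈ z∈B) (𝟙-∉ z∉C)))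
    ... | no z∉B  | yes z∈C = trans (𝟙-∈ (C⊆A z∈C)) (sym (cong₂ _+_ (𝟙-∉ z∉B) (𝟙-∈ z∈C)))
    ... | no z∉B  | no z∉C  = trans (𝟙-∉ z∉A) (sym (cong₂ _+_ (𝟙-∉ z∉B) (𝟙-∉ z∉C)))
      where
      z∉A : z ∉ A
      z∉A z∈A = [ z∉B , z∉C ]′ (split z∈A)

  ∣∣-permute : ∀ (A B : Subset n) (π : Permutation′ n) →
               (∀ {z} → z ∈ A → π ⟨$⟩ʳ z ∈ B) → (∀ {z} → π ⟨$⟩ʳ z ∈ B → z ∈ A) → ∣ A ∣ ≡ ∣ B ∣
  ∣∣-permute A B π A→B B→A = begin
    ∣ A ∣                      ≡⟨ ∣∣≡∑𝟙 A ⟩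
    ∑.sum (𝟙 A)                ≡⟨ ∑.sum-cong-≗ 𝟙-permute ⟩
    ∑.sum (𝟙 B ∘ (π ⟨$⟩ʳ_))    ≡⟨ ∑.sum-permute (𝟙 B) π ⟨
    ∑.sum (𝟙 B)                ≡⟨ ∣∣≡∑𝟙 B ⟨
    ∣ B ∣                      ∎
    where
    open ≡-Reasoning
    𝟙-permute : ∀ z → 𝟙 A z ≡ 𝟙 B (π ⟨$⟩ʳ z)
    𝟙-permute z with z ∈? A
    ... | yes z∈A = trans (𝟙-∈ z∈A) (sym (𝟙-∈ (A→B z∈A)))
    ... | no z∉A  = trans (𝟙-∉ z∉A) (sym (𝟙-∉ (z∉A ∘ B→A)))

  all∈? : ∀ (K : Subset n) {P : Pred (Fin n) 0ℓ} → Decidable P → Dec (∀ {x} → x ∈ K → P x)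
  all∈? K P? = Dec.map′ (λ f {x} → f x) (λ f x → f) (Fin.all? λ x → x ∈? K →-dec P? x)

  ¬all∈⇒∃ : ∀ (K : Subset n) {P : Pred (Fin n) 0ℓ} → Decidable P →
            ¬ (∀ {x} → x ∈ K → P x) → ∃ λ x → x ∈ K × ¬ P x
  ¬all∈⇒∃ K {P} P? ¬all with Fin.¬∀⟶∃¬ n (λ x → x ∈ K → P x) (λ x → x ∈? K →-dec P? x) (λ f → ¬all (f _))
  ... | x , ¬[x∈K→Px] with x ∈? K
  ...   | yes x∈K = x , x∈K , λ px → ¬[x∈K→Px] (λ _ → px)
  ...   | no x∉K  = contradiction (λ x∈K → contradiction x∈K x∉K) ¬[x∈K→Px]

module _ {n : ℕ} (G : FinGroup n) where
  open FinGroup G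
  open IsGroup isGroup using (assoc; identityˡ; identityʳ; inverseˡ; inverseʳ)

  group : Group 0ℓ 0ℓ
  group = record { Carrier = Fin n ; _≈_ = _≡_ ; _∙_ = _∙_ ; ε = ε ; _⁻¹ = _⁻¹ ; isGroup = isGroup }

  open GroupProperties group
    using (ε⁻¹≈ε; ⁻¹-involutive; ⁻¹-anti-homo-∙; inverseˡ-unique; inverseʳ-unique; ∙-cancelˡ;
           \\-leftDividesˡ; \\-leftDividesʳ; //-rightDividesʳ)

  -- Identities valid in every group, proved by comparing freely reduced words.
  module WordSolver where
    infixl 7 _⊗_
    data Expr (k : ℕ) : Set where
      var : Fin k → Expr k
      unit : Expr k
      _⊗_ : Expr k → Expr k → Expr k
      inv : Expr k → Expr k

    ⟦_⟧ : ∀ {k} → Expr k → Vec (Fin n) k → Fin n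
    ⟦ var i ⟧ ρ = Vec.lookup ρ i
    ⟦ unit ⟧ ρ = ε
    ⟦ a ⊗ b ⟧ ρ = ⟦ a ⟧ ρ ∙ ⟦ b ⟧ ρ
    ⟦ inv a ⟧ ρ = ⟦ a ⟧ ρ ⁻¹

    -- a letter is a variable, flagged true when inverted
    Letter : ℕ → Set
    Letter k = Fin k × Bool

    ⟦_⟧ₗ : ∀ {k} → Letter k → Vec (Fin n) k → Fin n
    ⟦ i , false ⟧ₗ ρ = Vec.lookup ρ i
    ⟦ i , true ⟧ₗ ρ = Vec.lookup ρ i ⁻¹

    ⟦_⟧ʷ : ∀ {k} → List (Letter k) → Vec (Fin n) k → Fin n
    ⟦ [] ⟧ʷ ρ = ε
    ⟦ l ∷ w ⟧ʷ ρ = ⟦ l ⟧ₗ ρ ∙ ⟦ w ⟧ʷ ρ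

    flip : ∀ {k} → Letter k → Letter k
    flip (i , b) = i , not b

    ⟦flip⟧ : ∀ {k} (l : Letter k) ρ → ⟦ flip l ⟧ₗ ρ ≡ ⟦ l ⟧ₗ ρ ⁻¹
    ⟦flip⟧ (i , false) ρ = refl
    ⟦flip⟧ (i , true) ρ = sym (⁻¹-involutive (Vec.lookup ρ i))

    flip? : ∀ {k} (l l′ : Letter k) → Dec (l′ ≡ flip l)
    flip? (i , b) (j , c) with j Fin.≟ i | c Bool.≟ not b
    ... | yes refl | yes refl = yes refl
    ... | no j≢i   | _        = no λ { refl → j≢i refl }
    ... | yes _    | no c≢b   = no λ { refl → c≢b refl }

    cons : ∀ {k} → Letter k → List (Letter k) → List (Letter k)
    cons l [] = l ∷ []
    cons l (l′ ∷ w) with flip? l l′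
    ... | yes _ = w
    ... | no _  = l ∷ l′ ∷ w

    ⟦cons⟧ : ∀ {k} l (w : List (Letter k)) ρ → ⟦ cons l w ⟧ʷ ρ ≡ ⟦ l ⟧ₗ ρ ∙ ⟦ w ⟧ʷ ρ
    ⟦cons⟧ l [] ρ = refl
    ⟦cons⟧ l (l′ ∷ w) ρ with flip? l l′
    ... | no _     = refl
    ... | yes refl = begin
      ⟦ w ⟧ʷ ρ                                   ≡⟨ \\-leftDividesʳ (⟦ l ⟧ₗ ρ ⁻¹) (⟦ w ⟧ʷ ρ) ⟨
      ⟦ l ⟧ₗ ρ ⁻¹ ⁻¹ ∙ (⟦ l ⟧ₗ ρ ⁻¹ ∙ ⟦ w ⟧ʷ ρ)   ≡⟨ cong₂ (λ a b → a ∙ (b ∙ ⟦ w ⟧ʷ ρ)) (⁻¹-involutive _) (sym (⟦flip⟧ l ρ)) ⟩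
      ⟦ l ⟧ₗ ρ ∙ (⟦ flip l ⟧ₗ ρ ∙ ⟦ w ⟧ʷ ρ)       ∎
      where open ≡-Reasoning

    append : ∀ {k} → List (Letter k) → List (Letter k) → List (Letter k)
    append [] w = w
    append (l ∷ u) w = cons l (append u w)

    ⟦append⟧ : ∀ {k} (u w : List (Letter k)) ρ → ⟦ append u w ⟧ʷ ρ ≡ ⟦ u ⟧ʷ ρ ∙ ⟦ w ⟧ʷ ρ
    ⟦append⟧ [] w ρ = sym (identityˡ _)
    ⟦append⟧ (l ∷ u) w ρ = begin
      ⟦ cons l (append u w) ⟧ʷ ρ         ≡⟨ ⟦cons⟧ l (append u w) ρ ⟩
      ⟦ l ⟧ₗ ρ ∙ ⟦ append u w ⟧ʷ ρ       ≡⟨ cong (⟦ l ⟧ₗ ρ ∙_) (⟦append⟧ u w ρ) ⟩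
      ⟦ l ⟧ₗ ρ ∙ (⟦ u ⟧ʷ ρ ∙ ⟦ w ⟧ʷ ρ)   ≡⟨ assoc _ _ _ ⟨
      ⟦ l ⟧ₗ ρ ∙ ⟦ u ⟧ʷ ρ ∙ ⟦ w ⟧ʷ ρ     ∎
      where open ≡-Reasoning

    reverse : ∀ {k} → List (Letter k) → List (Letter k)
    reverse [] = []
    reverse (l ∷ w) = append (reverse w) (flip l ∷ [])

    ⟦reverse⟧ : ∀ {k} (w : List (Letter k)) ρ → ⟦ reverse w ⟧ʷ ρ ≡ ⟦ w ⟧ʷ ρ ⁻¹
    ⟦reverse⟧ [] ρ = sym ε⁻¹≈ε
    ⟦reverse⟧ (l ∷ w) ρ = begin
      ⟦ append (reverse w) (flip l ∷ []) ⟧ʷ ρ   ≡⟨ ⟦append⟧ (reverse w) (flip l ∷ []) ρ ⟩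
      ⟦ reverse w ⟧ʷ ρ ∙ (⟦ flip l ⟧ₗ ρ ∙ ε)     ≡⟨ cong₂ _∙_ (⟦reverse⟧ w ρ) (trans (identityʳ _) (⟦flip⟧ l ρ)) ⟩
      ⟦ w ⟧ʷ ρ ⁻¹ ∙ ⟦ l ⟧ₗ ρ ⁻¹                  ≡⟨ ⁻¹-anti-homo-∙ _ _ ⟨
      (⟦ l ⟧ₗ ρ ∙ ⟦ w ⟧ʷ ρ) ⁻¹                   ∎
      where open ≡-Reasoning

    normalise : ∀ {k} → Expr k → List (Letter k)
    normalise (var i) = (i , false) ∷ []
    normalise unit = []
    normalise (a ⊗ b) = append (normalise a) (normalise b)
    normalise (inv a) = reverse (normalise a)

    ⟦normalise⟧ : ∀ {k} (a : Expr k) ρ → ⟦ normalise a ⟧ʷ ρ ≡ ⟦ a ⟧ ρ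
    ⟦normalise⟧ (var i) ρ = identityʳ _
    ⟦normalise⟧ unit ρ = refl
    ⟦normalise⟧ (a ⊗ b) ρ = trans (⟦append⟧ (normalise a) (normalise b) ρ) (cong₂ _∙_ (⟦normalise⟧ a ρ) (⟦normalise⟧ b ρ))
    ⟦normalise⟧ (inv a) ρ = trans (⟦reverse⟧ (normalise a) ρ) (cong _⁻¹ (⟦normalise⟧ a ρ))

    solve : ∀ {k} (a b : Expr k) → normalise a ≡ normalise b → ∀ ρ → ⟦ a ⟧ ρ ≡ ⟦ b ⟧ ρ
    solve a b a≈b ρ = trans (sym (⟦normalise⟧ a ρ)) (trans (cong (λ w → ⟦ w ⟧ʷ ρ) a≈b) (⟦normalise⟧ b ρ))

    x₀ : ∀ {k} → Expr (1 + k)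
    x₀ = var Fin.zero
    x₁ : ∀ {k} → Expr (2 + k)
    x₁ = var (Fin.suc Fin.zero)
    x₂ : ∀ {k} → Expr (3 + k)
    x₂ = var (Fin.suc (Fin.suc Fin.zero))
    x₃ : ∀ {k} → Expr (4 + k)
    x₃ = var (Fin.suc (Fin.suc (Fin.suc Fin.zero)))
    x₄ : ∀ {k} → Expr (5 + k)
    x₄ = var (Fin.suc (Fin.suc (Fin.suc (Fin.suc Fin.zero))))

    conjₑ commₑ : ∀ {k} → Expr k → Expr k → Expr k
    conjₑ g h = inv g ⊗ h ⊗ g
    commₑ x y = inv x ⊗ inv y ⊗ x ⊗ y

  open WordSolver using (solve; x₀; x₁; x₂; x₃; x₄; unit; _⊗_; inv; conjₑ; commₑ)

  ε⁻¹-identityˡ : ∀ y → ε ⁻¹ ∙ y ≡ y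
  ε⁻¹-identityˡ y = trans (cong (_∙ y) ε⁻¹≈ε) (identityˡ y)

  private variable
    K L M : Subset n
    g h x y : Fin n

  conj-ε : ∀ h → conj G ε h ≡ h
  conj-ε h = solve (conjₑ unit x₀) x₀ refl (h ∷ [])

  conj-∙ : ∀ x g h → conj G (x ∙ g) h ≡ conj G g (conj G x h)
  conj-∙ x g h = solve (conjₑ (x₀ ⊗ x₁) x₂) (conjₑ x₁ (conjₑ x₀ x₂)) refl (x ∷ g ∷ h ∷ [])

  conj-homo-∙ : ∀ g a b → conj G g (a ∙ b) ≡ conj G g a ∙ conj G g b
  conj-homo-∙ g a b = solve (conjₑ x₀ (x₁ ⊗ x₂)) (conjₑ x₀ x₁ ⊗ conjₑ x₀ x₂) refl (g ∷ a ∷ b ∷ [])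

  conj-homo-ε : ∀ g → conj G g ε ≡ ε
  conj-homo-ε g = solve (conjₑ x₀ unit) unit refl (g ∷ [])

  conj≡∙commutator : ∀ x a → conj G x a ≡ a ∙ commutator G a x
  conj≡∙commutator x a = solve (conjₑ x₀ x₁) (x₁ ⊗ commₑ x₁ x₀) refl (x ∷ a ∷ [])

  commutator-⁻¹ : ∀ a x → commutator G a x ≡ commutator G x a ⁻¹
  commutator-⁻¹ a x = solve (commₑ x₀ x₁) (inv (commₑ x₁ x₀)) refl (a ∷ x ∷ [])

  commutator≡⁻¹∙conj : ∀ s g → commutator G s g ≡ s ⁻¹ ∙ conj G g s
  commutator≡⁻¹∙conj s g = solve (commₑ x₀ x₁) (inv x₀ ⊗ conjₑ x₁ x₀) refl (s ∷ g ∷ [])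

  commutator-∙ˡ : ∀ a b y → commutator G (a ∙ b) y ≡ conj G b (commutator G a y) ∙ commutator G b y
  commutator-∙ˡ a b y = solve (commₑ (x₀ ⊗ x₁) x₂) (conjₑ x₁ (commₑ x₀ x₂) ⊗ commₑ x₁ x₂) refl (a ∷ b ∷ y ∷ [])

  commutator-εˡ : ∀ y → commutator G ε y ≡ ε
  commutator-εˡ y = solve (commₑ unit x₀) unit refl (y ∷ [])

  infixl 8 _^ᵍ_
  _^ᵍ_ : Fin n → ℕ → Fin n
  x ^ᵍ zero = ε
  x ^ᵍ suc k = x ^ᵍ k ∙ x

  ^ᵍ-identityʳ : ∀ x → x ^ᵍ 1 ≡ x
  ^ᵍ-identityʳ = identityˡ

  ^ᵍ-+ : ∀ x a b → x ^ᵍ (a + b) ≡ x ^ᵍ a ∙ x ^ᵍ b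
  ^ᵍ-+ x a zero = trans (cong (x ^ᵍ_) (+-identityʳ a)) (sym (identityʳ _))
  ^ᵍ-+ x a (suc b) = trans (cong (x ^ᵍ_) (+-suc a b)) (trans (cong (_∙ x) (^ᵍ-+ x a b)) (assoc _ _ _))

  ^ᵍ-* : ∀ x a b → x ^ᵍ (a * b) ≡ x ^ᵍ a ^ᵍ b
  ^ᵍ-* x a zero = cong (x ^ᵍ_) (*-zeroʳ a)
  ^ᵍ-* x a (suc b) = begin
    x ^ᵍ (a * suc b)          ≡⟨ cong (x ^ᵍ_) (trans (*-suc a b) (+-comm a (a * b))) ⟩
    x ^ᵍ (a * b + a)          ≡⟨ ^ᵍ-+ x (a * b) a ⟩
    x ^ᵍ (a * b) ∙ x ^ᵍ a     ≡⟨ cong (_∙ x ^ᵍ a) (^ᵍ-* x a b) ⟩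
    x ^ᵍ a ^ᵍ b ∙ x ^ᵍ a      ∎
    where open ≡-Reasoning

  ^ᵍ-*-comm : ∀ x a b → x ^ᵍ a ^ᵍ b ≡ x ^ᵍ b ^ᵍ a
  ^ᵍ-*-comm x a b = trans (sym (^ᵍ-* x a b)) (trans (cong (x ^ᵍ_) (*-comm a b)) (^ᵍ-* x b a))

  ε^ᵍ : ∀ k → ε ^ᵍ k ≡ ε
  ε^ᵍ zero = refl
  ε^ᵍ (suc k) = trans (identityʳ _) (ε^ᵍ k)

  ^ᵍ≡ε⇒^ᵍ*≡ε : ∀ {x} a b → x ^ᵍ a ≡ ε → x ^ᵍ (a * b) ≡ ε
  ^ᵍ≡ε⇒^ᵍ*≡ε {x} a b xᵃ≡ε = trans (^ᵍ-* x a b) (trans (cong (_^ᵍ b) xᵃ≡ε) (ε^ᵍ b))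

  conj-^ᵍ : ∀ g x k → conj G g x ^ᵍ k ≡ conj G g (x ^ᵍ k)
  conj-^ᵍ g x zero = sym (conj-homo-ε g)
  conj-^ᵍ g x (suc k) = trans (cong (_∙ conj G g x) (conj-^ᵍ g x k)) (sym (conj-homo-∙ g _ _))

  ⁻¹-^ᵍ : ∀ x k → x ⁻¹ ^ᵍ k ≡ x ^ᵍ k ⁻¹
  ⁻¹-^ᵍ x zero = sym ε⁻¹≈ε
  ⁻¹-^ᵍ x (suc k) = begin
    x ⁻¹ ^ᵍ k ∙ x ⁻¹        ≡⟨ cong (_∙ x ⁻¹) (⁻¹-^ᵍ x k) ⟩
    x ^ᵍ k ⁻¹ ∙ x ⁻¹        ≡⟨ ⁻¹-anti-homo-∙ x (x ^ᵍ k) ⟨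
    (x ∙ x ^ᵍ k) ⁻¹         ≡⟨ cong (λ y → (y ∙ x ^ᵍ k) ⁻¹) (^ᵍ-identityʳ x) ⟨
    (x ^ᵍ 1 ∙ x ^ᵍ k) ⁻¹    ≡⟨ cong _⁻¹ (^ᵍ-+ x 1 k) ⟨
    x ^ᵍ suc k ⁻¹           ∎
    where open ≡-Reasoning

  torsion : ∀ x → ∃ λ d → 0 < d × d ≤ n × x ^ᵍ d ≡ ε
  torsion x with Fin.pigeonhole (n<1+n n) (λ (i : Fin (suc n)) → x ^ᵍ toℕ i)
  ... | i , j , i<j , xⁱ≡xʲ = d , m<n⇒0<n∸m i<j , d≤n , ∙-cancelˡ (x ^ᵍ toℕ i) _ _ xⁱxᵈ≡xⁱε
    where
    d = toℕ j ∸ toℕ i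
    d≤n : d ≤ n
    d≤n = ≤-trans (m∸n≤m (toℕ j) (toℕ i)) (≤-pred (Fin.toℕ<n j))
    xⁱxᵈ≡xⁱε : x ^ᵍ toℕ i ∙ x ^ᵍ d ≡ x ^ᵍ toℕ i ∙ ε
    xⁱxᵈ≡xⁱε = begin
      x ^ᵍ toℕ i ∙ x ^ᵍ d    ≡⟨ ^ᵍ-+ x (toℕ i) d ⟨
      x ^ᵍ (toℕ i + d)       ≡⟨ cong (x ^ᵍ_) (m+[n∸m]≡n (<⇒≤ i<j)) ⟩
      x ^ᵍ toℕ j             ≡⟨ xⁱ≡xʲ ⟨
      x ^ᵍ toℕ i             ≡⟨ identityʳ _ ⟨
      x ^ᵍ toℕ i ∙ ε         ∎
      where open ≡-Reasoning

  ⁻¹≡^ᵍ : ∀ x → ∃ λ k → x ⁻¹ ≡ x ^ᵍ k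
  ⁻¹≡^ᵍ x with torsion x
  ... | suc k , _ , _ , xᵏx≡ε = k , sym (inverseˡ-unique (x ^ᵍ k) x xᵏx≡ε)

  ε∈ : IsSubgroup G K → ε ∈ K
  ε∈ (ε∈K , _ , _) = ε∈K

  ∙∈ : IsSubgroup G K → x ∈ K → y ∈ K → x ∙ y ∈ K
  ∙∈ (_ , ∙∈K , _) = ∙∈K

  ⁻¹∈ : IsSubgroup G K → x ∈ K → x ⁻¹ ∈ K
  ⁻¹∈ (_ , _ , ⁻¹∈K) = ⁻¹∈K

  ^ᵍ∈ : IsSubgroup G K → x ∈ K → ∀ k → x ^ᵍ k ∈ K
  ^ᵍ∈ K≤ x∈K zero = ε∈ K≤
  ^ᵍ∈ K≤ x∈K (suc k) = ∙∈ K≤ (^ᵍ∈ K≤ x∈K k) x∈K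

  conj∈ : IsSubgroup G K → g ∈ K → h ∈ K → conj G g h ∈ K
  conj∈ K≤ g∈K h∈K = ∙∈ K≤ (∙∈ K≤ (⁻¹∈ K≤ g∈K) h∈K) g∈K

  commutator∈ : IsSubgroup G K → x ∈ K → y ∈ K → commutator G x y ∈ K
  commutator∈ K≤ x∈K y∈K = ∙∈ K≤ (∙∈ K≤ (∙∈ K≤ (⁻¹∈ K≤ x∈K) (⁻¹∈ K≤ y∈K)) x∈K) y∈K

  ∙∈⇒∈ˡ : IsSubgroup G K → x ∙ y ∈ K → y ∈ K → x ∈ K
  ∙∈⇒∈ˡ {K = K} {x = x} {y = y} K≤ xy∈K y∈K = subst (_∈ K) (//-rightDividesʳ y x) (∙∈ K≤ xy∈K (⁻¹∈ K≤ y∈K))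

  -- x⁻¹ is a power of x, so closure under inverses comes for free
  closed⇒subgroup : {P : Pred (Fin n) 0ℓ} (P? : Decidable P) →
                    P ε → (∀ {x y} → P x → P y → P (x ∙ y)) → IsSubgroup G (toSubset P?)
  closed⇒subgroup {P} P? Pε P∙ = toSubset⁺ P? Pε
                               , (λ x∈ y∈ → toSubset⁺ P? (P∙ (toSubset⁻ P? x∈) (toSubset⁻ P? y∈)))
                               , λ x∈ → toSubset⁺ P? (P⁻¹ (toSubset⁻ P? x∈))
    where
    P^ᵍ : ∀ {x} → P x → ∀ k → P (x ^ᵍ k)
    P^ᵍ Px zero = Pε
    P^ᵍ Px (suc k) = P∙ (P^ᵍ Px k) Px
    P⁻¹ : ∀ {x} → P x → P (x ⁻¹)
    P⁻¹ {x} Px with ⁻¹≡^ᵍ x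
    ... | k , x⁻¹≡xᵏ = subst P (sym x⁻¹≡xᵏ) (P^ᵍ Px k)

  ⊤-subgroup : IsSubgroup G ⊤
  ⊤-subgroup = ∈⊤ , (λ _ _ → ∈⊤) , λ _ → ∈⊤

  coprime-^ᵍ∈ : ∀ {a b} → IsSubgroup G K → Coprime a b → x ^ᵍ a ∈ K → x ^ᵍ b ∈ K → x ∈ K
  coprime-^ᵍ∈ {K = K} {x = x} {a} {b} K≤ a⊥b xᵃ∈K xᵇ∈K = by-Bézout (coprime-Bézout a⊥b)
    where
    from-identity : ∀ {c d} u w → 1 + w * d ≡ u * c → x ^ᵍ c ∈ K → x ^ᵍ d ∈ K → x ∈ K
    from-identity {c} {d} u w 1+wd≡uc xᶜ∈K xᵈ∈K = ∙∈⇒∈ˡ K≤ (subst (_∈ K) xᵘᶜ≡x∙xʷᵈ (^ᵍ∈ K≤ xᶜ∈K u)) xʷᵈ∈K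
      where
      xʷᵈ∈K : x ^ᵍ (w * d) ∈ K
      xʷᵈ∈K = subst (_∈ K) (trans (sym (^ᵍ-* x d w)) (cong (x ^ᵍ_) (*-comm d w))) (^ᵍ∈ K≤ xᵈ∈K w)
      xᵘᶜ≡x∙xʷᵈ : x ^ᵍ c ^ᵍ u ≡ x ∙ x ^ᵍ (w * d)
      xᵘᶜ≡x∙xʷᵈ = begin
        x ^ᵍ c ^ᵍ u           ≡⟨ ^ᵍ-* x c u ⟨
        x ^ᵍ (c * u)          ≡⟨ cong (x ^ᵍ_) (trans (*-comm c u) (sym 1+wd≡uc)) ⟩
        x ^ᵍ (1 + w * d)      ≡⟨ ^ᵍ-+ x 1 (w * d) ⟩
        x ^ᵍ 1 ∙ x ^ᵍ (w * d) ≡⟨ cong (_∙ x ^ᵍ (w * d)) (^ᵍ-identityʳ x) ⟩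
        x ∙ x ^ᵍ (w * d)      ∎
        where open ≡-Reasoning
    by-Bézout : Bézout.Identity 1 a b → x ∈ K
    by-Bézout (Bézout.+- u w 1+wb≡ua) = from-identity u w 1+wb≡ua xᵃ∈K xᵇ∈K
    by-Bézout (Bézout.-+ u w 1+ua≡wb) = from-identity w u 1+ua≡wb xᵇ∈K xᵃ∈K

  trivial : Subset n
  trivial = toSubset (_≟ ε)

  trivial-subgroup : IsSubgroup G trivial
  trivial-subgroup = closed⇒subgroup (_≟ ε) refl λ { refl refl → identityˡ ε }

  coprime-^ᵍ≡ε : ∀ {a b} → Coprime a b → x ^ᵍ a ≡ ε → x ^ᵍ b ≡ ε → x ≡ ε
  coprime-^ᵍ≡ε a⊥b xᵃ≡ε xᵇ≡ε =
    toSubset⁻ (_≟ ε) (coprime-^ᵍ∈ trivial-subgroup a⊥b (toSubset⁺ (_≟ ε) xᵃ≡ε) (toSubset⁺ (_≟ ε) xᵇ≡ε))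

  Normalises : Subset n → Fin n → Set
  Normalises K g = ∀ {k} → k ∈ K → conj G g k ∈ K

  Normalises? : ∀ K → Decidable (Normalises K)
  Normalises? K g = all∈? K (λ k → conj G g k ∈? K)

  normaliser : Subset n → Subset n
  normaliser K = toSubset (Normalises? K)

  normaliser-subgroup : ∀ K → IsSubgroup G (normaliser K)
  normaliser-subgroup K = closed⇒subgroup (Normalises? K) (λ {k} k∈K → subst (_∈ K) (sym (conj-ε k)) k∈K)
                            λ {x} {y} x-norm y-norm {k} k∈K → subst (_∈ K) (sym (conj-∙ x y k)) (y-norm (x-norm k∈K))

  ⊆normaliser : IsSubgroup G K → K ⊆ normaliser K
  ⊆normaliser K≤ g∈K = toSubset⁺ (Normalises? _) (conj∈ K≤ g∈K)

  Normalises-^ᵍ : Normalises K x → ∀ j → Normalises K (x ^ᵍ j)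
  Normalises-^ᵍ {K} x-norm j =
    toSubset⁻ (Normalises? K) (^ᵍ∈ (normaliser-subgroup K) (toSubset⁺ (Normalises? K) x-norm) j)

  UpperCentral? : ∀ i → Decidable (UpperCentral G i)
  UpperCentral? zero x = x ≟ ε
  UpperCentral? (suc i) x = Fin.all? λ g → UpperCentral? i (commutator G x g)

  CentralModulo : Subset n → Subset n → Fin n → Set
  CentralModulo M L x = x ∈ L × x ∉ M × (∀ {z} → z ∈ L → commutator G x z ∈ M)

  central-modulo : Nilpotent G → IsSubgroup G M → IsSubgroup G L → y ∈ L → y ∉ M → ∃ (CentralModulo M L)
  central-modulo {M} {L} {y} (c , upper-central) M≤ L≤ y∈L y∉M =
    [ (λ L∩Z⊆M → contradiction (L∩Z⊆M (upper-central y) y∈L) y∉M) , id ]′ (climb c)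
    where
    climb : ∀ j → (∀ {y} → UpperCentral G j y → y ∈ L → y ∈ M) ⊎ ∃ (CentralModulo M L)
    climb zero = inj₁ λ y≡ε _ → subst (_∈ M) (sym y≡ε) (ε∈ M≤)
    climb (suc j) with climb j
    ... | inj₂ central = inj₂ central
    ... | inj₁ L∩Zⱼ⊆M with Fin.any? (λ x → UpperCentral? (suc j) x ×-dec x ∈? L ×-dec ¬? (x ∈? M))
    ...   | yes (x , x∈Zⱼ₊₁ , x∈L , x∉M) = inj₂ (x , x∈L , x∉M , λ z∈L → L∩Zⱼ⊆M (x∈Zⱼ₊₁ _) (commutator∈ L≤ x∈L z∈L))
    ...   | no ∄x = inj₁ λ {y} y∈Zⱼ₊₁ y∈L → decidable-stable (y ∈? M) λ y∉M → ∄x (y , y∈Zⱼ₊₁ , y∈L , y∉M)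

  normaliser-condition : Nilpotent G → IsSubgroup G M → y ∉ M → ∃ λ x → x ∉ M × x ∈ normaliser M
  normaliser-condition {M} nil M≤ y∉M with central-modulo nil M≤ ⊤-subgroup ∈⊤ y∉M
  ... | x , _ , x∉M , [x,-]∈M = x , x∉M , toSubset⁺ (Normalises? M) conj-x∈M
    where
    conj-x∈M : Normalises M x
    conj-x∈M {a} a∈M = subst (_∈ M) (sym (conj≡∙commutator x a))
                         (∙∈ M≤ a∈M (subst (_∈ M) (sym (commutator-⁻¹ a x)) (⁻¹∈ M≤ ([x,-]∈M ∈⊤))))

  -- Elements of prime-power order

  PElement : ℕ → Fin n → Set
  PElement p x = ∃ λ a → x ^ᵍ (p ^ a) ≡ ε

  PElement-bound : ∀ {p} → Prime p → PElement p x → x ^ᵍ (p ^ n) ≡ ε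
  PElement-bound {x} {p} pr (a , xᵖᵃ≡ε) with torsion x
  ... | d , 0<d , d≤n , xᵈ≡ε with prime-part pr d 0<d
  ...   | b , m , refl , p∤m = begin
    x ^ᵍ (p ^ n)                 ≡⟨ cong (λ e → x ^ᵍ (p ^ e)) (m+[n∸m]≡n b≤n) ⟨
    x ^ᵍ (p ^ (b + (n ∸ b)))     ≡⟨ cong (x ^ᵍ_) (^-distribˡ-+-* p b (n ∸ b)) ⟩
    x ^ᵍ (p ^ b * p ^ (n ∸ b))   ≡⟨ ^ᵍ≡ε⇒^ᵍ*≡ε (p ^ b) (p ^ (n ∸ b)) xᵖᵇ≡ε ⟩
    ε                            ∎
    where
    open ≡-Reasoning
    m≢0 : NonZero m
    m≢0 = ≢-nonZero λ { refl → <-irrefl (sym (*-zeroʳ (p ^ b))) 0<d }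
    b≤n : b ≤ n
    b≤n = <⇒≤ (<-≤-trans (n<m^n (prime>1 pr) b) (≤-trans (m≤m*n (p ^ b) m {{m≢0}}) d≤n))
    xᵖᵇ≡ε : x ^ᵍ (p ^ b) ≡ ε
    xᵖᵇ≡ε = coprime-^ᵍ≡ε (coprime-^ a (∤⇒coprime pr p∤m))
              (trans (sym (^ᵍ-* x (p ^ b) m)) xᵈ≡ε)
              (trans (^ᵍ-*-comm x (p ^ b) (p ^ a)) (trans (cong (_^ᵍ (p ^ b)) xᵖᵃ≡ε) (ε^ᵍ (p ^ b))))

  PElement? : ∀ {p} → Prime p → Decidable (PElement p)
  PElement? {p} pr x = Dec.map′ (n ,_) (PElement-bound pr) (x ^ᵍ (p ^ n) ≟ ε)

  PElement-ε : ∀ {p} → PElement p ε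
  PElement-ε = 0 , ε^ᵍ 1

  PElement-conj : ∀ {p} g → PElement p x → PElement p (conj G g x)
  PElement-conj {x} {p} g (a , xᵖᵃ≡ε) =
    a , trans (conj-^ᵍ g x (p ^ a)) (trans (cong (conj G g) xᵖᵃ≡ε) (conj-homo-ε g))

  PElement-⁻¹ : ∀ {p} → PElement p x → PElement p (x ⁻¹)
  PElement-⁻¹ {x} {p} (a , xᵖᵃ≡ε) = a , trans (⁻¹-^ᵍ x (p ^ a)) (trans (cong _⁻¹ xᵖᵃ≡ε) ε⁻¹≈ε)

  PElement-^ᵍ : ∀ {p} k → PElement p x → PElement p (x ^ᵍ k)
  PElement-^ᵍ {x} {p} k (a , xᵖᵃ≡ε) = a , trans (^ᵍ-*-comm x k (p ^ a)) (trans (cong (_^ᵍ k) xᵖᵃ≡ε) (ε^ᵍ k))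

  PElement-root : ∀ {p} b → PElement p (x ^ᵍ (p ^ b)) → PElement p x
  PElement-root {x} {p} b (a , e) = b + a , trans (cong (x ^ᵍ_) (^-distribˡ-+-* p b a)) (trans (^ᵍ-* x (p ^ b) (p ^ a)) e)

  ^ᵍ-∙-modulo : IsSubgroup G M → Normalises M x → y ∈ M → ∀ e → (x ^ᵍ e) ⁻¹ ∙ (x ∙ y) ^ᵍ e ∈ M
  ^ᵍ-∙-modulo {M} M≤ x-norm y∈M zero = subst (_∈ M) (sym (trans (identityʳ _) ε⁻¹≈ε)) (ε∈ M≤)
  ^ᵍ-∙-modulo {M} {x} {y} M≤ x-norm y∈M (suc e) = subst (_∈ M)
    (solve (conjₑ x₁ (inv x₀ ⊗ x₂) ⊗ x₃) (inv (x₀ ⊗ x₁) ⊗ (x₂ ⊗ (x₁ ⊗ x₃))) refl (x ^ᵍ e ∷ x ∷ (x ∙ y) ^ᵍ e ∷ y ∷ []))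
    (∙∈ M≤ (x-norm (^ᵍ-∙-modulo M≤ x-norm y∈M e)) y∈M)

  -- ⟨ M , x ⟩ as the union of the cosets x ^ i M, i < e; a subgroup when x normalises M and x ^ e ∈ M
  Adjoined : Subset n → Fin n → ℕ → Fin n → Set
  Adjoined M x e y = ∃ λ i → i < e × (x ^ᵍ i) ⁻¹ ∙ y ∈ M

  Adjoined? : ∀ M x e → Decidable (Adjoined M x e)
  Adjoined? M x e y = Dec.map′ (λ { (i , m) → toℕ i , Fin.toℕ<n i , m })
                        (λ { (i , i<e , m) → fromℕ< i<e , subst (λ j → (x ^ᵍ j) ⁻¹ ∙ y ∈ M) (sym (Fin.toℕ-fromℕ< i<e)) m })
                        (Fin.any? {n = e} λ i → (x ^ᵍ toℕ i) ⁻¹ ∙ y ∈? M)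

  adjoin : Subset n → Fin n → ℕ → Subset n
  adjoin M x e = toSubset (Adjoined? M x e)

  module Adjoin {M} (M≤ : IsSubgroup G M) {x} (x-norm : Normalises M x) {e} (0<e : 0 < e) (xᵉ∈M : x ^ᵍ e ∈ M) where
    reach : ∀ t → Adjoined M x e (x ^ᵍ t)
    reach zero = 0 , 0<e , subst (_∈ M) (sym (ε⁻¹-identityˡ ε)) (ε∈ M≤)
    reach (suc t) with reach t
    ... | i , i<e , m with suc i <? e
    ...   | yes i+1<e = suc i , i+1<e , subst (_∈ M)
              (solve (conjₑ x₂ (inv x₀ ⊗ x₁)) (inv (x₀ ⊗ x₂) ⊗ (x₁ ⊗ x₂)) refl (x ^ᵍ i ∷ x ^ᵍ t ∷ x ∷ []))
              (x-norm m)
    ...   | no i+1≮e = 0 , 0<e , subst (_∈ M)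
              (solve ((x₀ ⊗ x₂) ⊗ conjₑ x₂ (inv x₀ ⊗ x₁)) (inv unit ⊗ (x₁ ⊗ x₂)) refl (x ^ᵍ i ∷ x ^ᵍ t ∷ x ∷ []))
              (∙∈ M≤ (subst (λ j → x ^ᵍ j ∈ M) (sym (≤-antisym i<e (≮⇒≥ i+1≮e))) xᵉ∈M) (x-norm m))

    subgroup : IsSubgroup G (adjoin M x e)
    subgroup = closed⇒subgroup (Adjoined? M x e) (reach 0) adjoined-∙
      where
      adjoined-∙ : ∀ {y z} → Adjoined M x e y → Adjoined M x e z → Adjoined M x e (y ∙ z)
      adjoined-∙ {y} {z} (i , _ , m₁) (j , _ , m₂) with reach (i + j)
      ... | k , k<e , m₃ = k , k<e , subst (_∈ M)
            (solve ((inv x₀ ⊗ (x₁ ⊗ x₂)) ⊗ conjₑ x₂ (inv x₁ ⊗ x₃) ⊗ (inv x₂ ⊗ x₄)) (inv x₀ ⊗ (x₃ ⊗ x₄)) refl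
               (x ^ᵍ k ∷ x ^ᵍ i ∷ x ^ᵍ j ∷ y ∷ z ∷ []))
            (∙∈ M≤ (∙∈ M≤ (subst (λ w → (x ^ᵍ k) ⁻¹ ∙ w ∈ M) (^ᵍ-+ x i j) m₃) (Normalises-^ᵍ x-norm j m₁)) m₂)

    x∈adjoin : x ∈ adjoin M x e
    x∈adjoin = toSubset⁺ (Adjoined? M x e) (subst (Adjoined M x e) (^ᵍ-identityʳ x) (reach 1))

    M⊆adjoin : M ⊆ adjoin M x e
    M⊆adjoin {y} y∈M = toSubset⁺ (Adjoined? M x e) (0 , 0<e , subst (_∈ M) (sym (ε⁻¹-identityˡ y)) y∈M)

  coset : Subset n → Fin n → Subset n
  coset M a = toSubset (λ y → a ⁻¹ ∙ y ∈? M)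

  ∣coset∣ : ∀ M a → ∣ coset M a ∣ ≡ ∣ M ∣
  ∣coset∣ M a = ∣∣-permute (coset M a) M (permutation (a ⁻¹ ∙_) (a ∙_) (\\-leftDividesʳ a) (\\-leftDividesˡ a))
                  (toSubset⁻ (λ y → a ⁻¹ ∙ y ∈? M)) (toSubset⁺ (λ y → a ⁻¹ ∙ y ∈? M))

  adjoin-suc : ∀ {t} → y ∈ adjoin M x (suc t) → y ∈ adjoin M x t ⊎ y ∈ coset M (x ^ᵍ t)
  adjoin-suc {y} {M} {x} {t} y∈ with toSubset⁻ (Adjoined? M x (suc t)) y∈
  ... | i , i<t+1 , m with i <? t
  ...   | yes i<t = inj₁ (toSubset⁺ (Adjoined? M x t) (i , i<t , m))
  ...   | no i≮t = inj₂ (toSubset⁺ (λ y → (x ^ᵍ t) ⁻¹ ∙ y ∈? M)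
                           (subst (λ j → (x ^ᵍ j) ⁻¹ ∙ y ∈ M) (≤-antisym (≤-pred i<t+1) (≮⇒≥ i≮t)) m))

  -- two distinct cosets x ^ i M and x ^ t M with 0 < t - i < p would put x in M
  adjoin-coset-disjoint : ∀ {p} → Prime p → IsSubgroup G M → x ∉ M → x ^ᵍ p ∈ M →
                          ∀ {t} → t < p → y ∈ adjoin M x t → y ∉ coset M (x ^ᵍ t)
  adjoin-coset-disjoint {M} {x} {y} {p} pr M≤ x∉M xᵖ∈M {t} t<p y∈ y∈coset
    with toSubset⁻ (Adjoined? M x t) y∈
  ... | i , i<t , m = x∉M (coprime-^ᵍ∈ M≤ d⊥p xᵈ∈M xᵖ∈M)
    where
    d = t ∸ i
    d⊥p : Coprime d p
    d⊥p = Coprime.sym (prime⇒coprime pr {{>-nonZero (m<n⇒0<n∸m i<t)}} (≤-<-trans (m∸n≤m t i) t<p))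
    ≡xᵈ : (x ^ᵍ i) ⁻¹ ∙ y ∙ ((x ^ᵍ t) ⁻¹ ∙ y) ⁻¹ ≡ x ^ᵍ d
    ≡xᵈ = begin
      (x ^ᵍ i) ⁻¹ ∙ y ∙ ((x ^ᵍ t) ⁻¹ ∙ y) ⁻¹  ≡⟨ solve ((inv x₀ ⊗ x₂) ⊗ inv (inv x₁ ⊗ x₂)) (inv x₀ ⊗ x₁) refl (x ^ᵍ i ∷ x ^ᵍ t ∷ y ∷ []) ⟩
      (x ^ᵍ i) ⁻¹ ∙ x ^ᵍ t                   ≡⟨ cong (λ j → (x ^ᵍ i) ⁻¹ ∙ x ^ᵍ j) (m+[n∸m]≡n (<⇒≤ i<t)) ⟨
      (x ^ᵍ i) ⁻¹ ∙ x ^ᵍ (i + d)             ≡⟨ cong ((x ^ᵍ i) ⁻¹ ∙_) (^ᵍ-+ x i d) ⟩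
      (x ^ᵍ i) ⁻¹ ∙ (x ^ᵍ i ∙ x ^ᵍ d)        ≡⟨ \\-leftDividesʳ (x ^ᵍ i) (x ^ᵍ d) ⟩
      x ^ᵍ d                                 ∎
      where open ≡-Reasoning
    xᵈ∈M : x ^ᵍ d ∈ M
    xᵈ∈M = subst (_∈ M) ≡xᵈ (∙∈ M≤ m (⁻¹∈ M≤ (toSubset⁻ (λ y → (x ^ᵍ t) ⁻¹ ∙ y ∈? M) y∈coset)))

  ∣adjoin∣ : ∀ {p} → Prime p → IsSubgroup G M → x ∉ M → x ^ᵍ p ∈ M → ∀ t → t ≤ p → ∣ adjoin M x t ∣ ≡ t * ∣ M ∣
  ∣adjoin∣ {M} {x} pr M≤ x∉M xᵖ∈M zero _ = ∣∅∣ (adjoin M x 0) λ _ y∈ → no-index (toSubset⁻ (Adjoined? M x 0) y∈)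
    where
    no-index : ∀ {y} → ¬ Adjoined M x 0 y
    no-index (_ , () , _)
  ∣adjoin∣ {M} {x} {p} pr M≤ x∉M xᵖ∈M (suc t) t<p = begin
    ∣ adjoin M x (suc t) ∣                   ≡⟨ ∣⊎∣ _ _ _ adjoin-suc old⊆new coset⊆new (adjoin-coset-disjoint pr M≤ x∉M xᵖ∈M t<p) ⟩
    ∣ adjoin M x t ∣ + ∣ coset M (x ^ᵍ t) ∣  ≡⟨ cong₂ _+_ (∣adjoin∣ pr M≤ x∉M xᵖ∈M t (<⇒≤ t<p)) (∣coset∣ M (x ^ᵍ t)) ⟩
    t * ∣ M ∣ + ∣ M ∣                        ≡⟨ +-comm (t * ∣ M ∣) ∣ M ∣ ⟩
    suc t * ∣ M ∣                            ∎
    where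
    open ≡-Reasoning
    old⊆new : adjoin M x t ⊆ adjoin M x (suc t)
    old⊆new y∈ = let i , i<t , m = toSubset⁻ (Adjoined? M x t) y∈
                 in toSubset⁺ (Adjoined? M x (suc t)) (i , m<n⇒m<1+n i<t , m)
    coset⊆new : coset M (x ^ᵍ t) ⊆ adjoin M x (suc t)
    coset⊆new y∈ = toSubset⁺ (Adjoined? M x (suc t)) (t , n<1+n t , toSubset⁻ (λ y → (x ^ᵍ t) ⁻¹ ∙ y ∈? M) y∈)

  adjoin⊆ : ∀ {e} → IsSubgroup G L → M ⊆ L → x ∈ L → adjoin M x e ⊆ L
  adjoin⊆ {L} {M} {x} {e} L≤ M⊆L x∈L {y} y∈ =
    let i , _ , m = toSubset⁻ (Adjoined? M x e) y∈
    in subst (_∈ L) (\\-leftDividesˡ (x ^ᵍ i) y) (∙∈ L≤ (^ᵍ∈ L≤ x∈L i) (M⊆L m))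

  commutator-^ᵍ∈ : IsSubgroup G M → (∀ {z} → z ∈ L → Normalises M z) → x ∈ L →
                   (∀ {z} → z ∈ L → commutator G x z ∈ M) → ∀ k {z} → z ∈ L → commutator G (x ^ᵍ k) z ∈ M
  commutator-^ᵍ∈ {M} M≤ L-norm x∈L x-central zero {z} _ = subst (_∈ M) (sym (commutator-εˡ z)) (ε∈ M≤)
  commutator-^ᵍ∈ {M} {x = x} M≤ L-norm x∈L x-central (suc k) {z} z∈L =
    subst (_∈ M) (sym (commutator-∙ˡ (x ^ᵍ k) x z))
      (∙∈ M≤ (L-norm x∈L (commutator-^ᵍ∈ M≤ L-norm x∈L x-central k z∈L)) (x-central z∈L))

  adjoin-normalised : ∀ {e} → IsSubgroup G M → (∀ {z} → z ∈ L → Normalises M z) → x ∈ L →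
                      (∀ {z} → z ∈ L → commutator G x z ∈ M) → ∀ {z} → z ∈ L → Normalises (adjoin M x e) z
  adjoin-normalised {M} {L} {x} {e} M≤ L-norm x∈L x-central {z} z∈L {y} y∈ =
    let i , i<e , m = toSubset⁻ (Adjoined? M x e) y∈
        a = x ^ᵍ i
        eq : commutator G a z ∙ conj G z (a ⁻¹ ∙ y) ≡ a ⁻¹ ∙ conj G z y
        eq = solve (commₑ x₀ x₁ ⊗ conjₑ x₁ (inv x₀ ⊗ x₂)) (inv x₀ ⊗ conjₑ x₁ x₂) refl (a ∷ z ∷ y ∷ [])
    in toSubset⁺ (Adjoined? M x e)
         (i , i<e , subst (_∈ M) eq (∙∈ M≤ (commutator-^ᵍ∈ M≤ L-norm x∈L x-central i z∈L) (L-norm z∈L m)))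

  -- A p-subgroup containing the p-elements of its normaliser is normal by the normaliser
  -- condition, hence contains every p-element.
  module PElements (nil : Nilpotent G) {p} (pr : Prime p) where
    IsPSubgroup : Subset n → Set
    IsPSubgroup P = IsSubgroup G P × (∀ {y} → y ∈ P → PElement p y)

    HasAllNormalisingPElements : Subset n → Set
    HasAllNormalisingPElements P = ∀ {y} → y ∈ normaliser P → PElement p y → y ∈ P

    module AdjoinPElement {P} (P≤ : IsSubgroup G P) {x} (x-norm : Normalises P x) (x-p : PElement p x) =
      Adjoin P≤ x-norm (m^n>0 p {{prime⇒nonZero pr}} n) (subst (_∈ P) (sym (PElement-bound pr x-p)) (ε∈ P≤))

    adjoin-PSubgroup : IsPSubgroup M → Normalises M x → PElement p x → IsPSubgroup (adjoin M x (p ^ n))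
    adjoin-PSubgroup {M} {x} (M≤ , M-p) x-norm x-p =
      AdjoinPElement.subgroup M≤ x-norm x-p , λ y∈ → p-element (toSubset⁻ (Adjoined? M x (p ^ n)) y∈)
      where
      -- y = a (a⁻¹ y) with a = x ^ i, and a ^ p ^ n = ε, so y ^ p ^ n ∈ M
      p-element : ∀ {y} → Adjoined M x (p ^ n) y → PElement p y
      p-element {y} (i , _ , a⁻¹y∈M) = PElement-root n (M-p (subst (_∈ M) ≡yᵖⁿ
                                         (^ᵍ-∙-modulo M≤ (Normalises-^ᵍ x-norm i) a⁻¹y∈M (p ^ n))))
        where
        a = x ^ᵍ i
        ≡yᵖⁿ : (a ^ᵍ (p ^ n)) ⁻¹ ∙ (a ∙ (a ⁻¹ ∙ y)) ^ᵍ (p ^ n) ≡ y ^ᵍ (p ^ n)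
        ≡yᵖⁿ = trans (cong₂ (λ u v → u ⁻¹ ∙ v ^ᵍ (p ^ n)) (PElement-bound pr (PElement-^ᵍ i x-p)) (\\-leftDividesˡ a y))
                     (ε⁻¹-identityˡ _)

    maximal-PSubgroup : ∃ λ P → IsPSubgroup P × HasAllNormalisingPElements P
    maximal-PSubgroup = larger-rec Goal grow trivial trivial-PSubgroup
      where
      Goal : Subset n → Set
      Goal P = IsPSubgroup P → ∃ λ P → IsPSubgroup P × HasAllNormalisingPElements P
      trivial-PSubgroup : IsPSubgroup trivial
      trivial-PSubgroup = trivial-subgroup , λ y∈ → subst (PElement p) (sym (toSubset⁻ (_≟ ε) y∈)) PElement-ε
      grow : ∀ P → (∀ {P′} → ∣ P ∣ < ∣ P′ ∣ → Goal P′) → Goal P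
      grow P rec P-p with Fin.any? (λ y → y ∈? normaliser P ×-dec PElement? pr y ×-dec ¬? (y ∈? P))
      ... | no ∄y = P , P-p , λ {y} y∈N y-p → decidable-stable (y ∈? P) λ y∉P → ∄y (y , y∈N , y-p , y∉P)
      ... | yes (y , y∈N , y-p , y∉P) = rec (p⊂q⇒∣p∣<∣q∣ (A.M⊆adjoin , y , A.x∈adjoin , y∉P)) (adjoin-PSubgroup P-p y-norm y-p)
        where
        y-norm = toSubset⁻ (Normalises? P) y∈N
        module A = AdjoinPElement (proj₁ P-p) y-norm y-p

    normaliser-maximal : IsPSubgroup M → HasAllNormalisingPElements M → ∀ g → g ∈ normaliser M
    normaliser-maximal {M} (M≤ , M-p) maximal g = decidable-stable (g ∈? normaliser M) λ g∉N →
      let x , x∉N , x∈NN = normaliser-condition nil (normaliser-subgroup M) g∉N in x∉N (NN⊆N x∈NN)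
      where
      NN⊆N : normaliser (normaliser M) ⊆ normaliser M
      NN⊆N {x} x∈NN = toSubset⁺ (Normalises? M) λ k∈M →
        maximal (toSubset⁻ (Normalises? (normaliser M)) x∈NN (⊆normaliser M≤ k∈M)) (PElement-conj x (M-p k∈M))

    PElement-∙ : PElement p x → PElement p y → PElement p (x ∙ y)
    PElement-∙ {x} {y} x-p y-p with maximal-PSubgroup
    ... | P , P-p@(P≤ , P-elements) , maximal = P-elements (∙∈ P≤ (∈P x-p) (∈P y-p))
      where
      ∈P : ∀ {z} → PElement p z → z ∈ P
      ∈P {z} z-p = maximal (normaliser-maximal P-p maximal z) z-p

  -- [s , g] is at once an r-element s⁻¹ sᵍ and a q-element (g⁻¹)ˢ g
  PElements-commute : Nilpotent G → ∀ {r q s g} → Prime r → Prime q → r ≢ q →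
                      PElement r s → PElement q g → conj G g s ≡ s
  PElements-commute nil {r} {q} {s} {g} pr pq r≢q s-r g-q =
    trans (inverseʳ-unique (s ⁻¹) (conj G g s) (trans (sym (commutator≡⁻¹∙conj s g)) [s,g]≡ε)) (⁻¹-involutive s)
    where
    [s,g]-r : PElement r (commutator G s g)
    [s,g]-r = subst (PElement r) (sym (commutator≡⁻¹∙conj s g))
                (PElements.PElement-∙ nil pr (PElement-⁻¹ s-r) (PElement-conj g s-r))
    [s,g]-q : PElement q (commutator G s g)
    [s,g]-q = PElements.PElement-∙ nil pq (PElement-conj s (PElement-⁻¹ g-q)) g-q
    rⁿ⊥qⁿ : Coprime (r ^ n) (q ^ n)
    rⁿ⊥qⁿ = Coprime.sym (coprime-^ n (Coprime.sym (coprime-^ n (≢⇒coprime pq pr (r≢q ∘ sym)))))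
    [s,g]≡ε : commutator G s g ≡ ε
    [s,g]≡ε = coprime-^ᵍ≡ε rⁿ⊥qⁿ (PElement-bound pr [s,g]-r) (PElement-bound pq [s,g]-q)

  prime-power-element-outside : IsSubgroup G K → IsSubgroup G L → g ∈ L → g ∉ K →
                                ∃₂ λ q g′ → Prime q × PElement q g′ × g′ ∈ L × g′ ∉ K
  prime-power-element-outside {K} {L} {g} K≤ L≤ g∈L g∉K with torsion g
  ... | d , 0<d , _ , gᵈ≡ε = <-rec Goal search d 0<d gᵈ≡ε g∈L g∉K
    where
    Goal : ℕ → Set
    Goal d = 0 < d → ∀ {g} → g ^ᵍ d ≡ ε → g ∈ L → g ∉ K → ∃₂ λ q g′ → Prime q × PElement q g′ × g′ ∈ L × g′ ∉ K
    -- with d = q ^ b * m and q ∤ m, either g ^ m is a q-element outside K, or g ^ q ^ b lies outside K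
    search : ∀ d → (∀ {d′} → d′ < d → Goal d′) → Goal d
    search 1 rec _ {g} g¹≡ε _ g∉K = contradiction (subst (_∈ K) (sym (trans (sym (^ᵍ-identityʳ g)) g¹≡ε)) (ε∈ K≤)) g∉K
    search d@(suc (suc _)) rec 0<d {g} gᵈ≡ε g∈L g∉K with prime-divisor d (s≤s (s≤s z≤n))
    ... | q , pq , q∣d with prime-part pq d 0<d
    ...   | b , m , d≡qᵇm , q∤m with g ^ᵍ m ∈? K | g ^ᵍ (q ^ b) ∈? K
    ...     | no gᵐ∉K | _ = q , g ^ᵍ m , pq , (b , gᵐ-q) , ^ᵍ∈ L≤ g∈L m , gᵐ∉K
      where
      gᵐ-q : g ^ᵍ m ^ᵍ (q ^ b) ≡ ε
      gᵐ-q = trans (^ᵍ-*-comm g m (q ^ b)) (trans (sym (^ᵍ-* g (q ^ b) m)) (trans (cong (g ^ᵍ_) (sym d≡qᵇm)) gᵈ≡ε))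
    ...     | yes gᵐ∈K | yes gᵠᵇ∈K = contradiction (coprime-^ᵍ∈ K≤ (coprime-^ b (∤⇒coprime pq q∤m)) gᵐ∈K gᵠᵇ∈K) g∉K
    ...     | yes _ | no gᵠᵇ∉K = rec m<d 0<m (trans (sym (^ᵍ-* g (q ^ b) m)) (trans (cong (g ^ᵍ_) (sym d≡qᵇm)) gᵈ≡ε))
                                      (^ᵍ∈ L≤ g∈L (q ^ b)) gᵠᵇ∉K
      where
      m≢0 : m ≢ 0
      m≢0 refl = <-irrefl (trans (sym (*-zeroʳ (q ^ b))) (sym d≡qᵇm)) 0<d
      0<m : 0 < m
      0<m = n≢0⇒n>0 m≢0
      b≢0 : b ≢ 0
      b≢0 refl = q∤m (subst (q ∣_) (trans d≡qᵇm (+-identityʳ m)) q∣d)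
      1<qᵇ : 1 < q ^ b
      1<qᵇ = ≤-<-trans (n≢0⇒n>0 b≢0) (n<m^n (prime>1 pq) b)
      m<d : m < d
      m<d = subst (m <_) (trans (*-comm m (q ^ b)) (sym d≡qᵇm)) (m<m*n m (q ^ b) {{≢-nonZero m≢0}} 1<qᵇ)

  index-prime-power : Nilpotent G → ∀ {p} → Prime p → IsSubgroup G K → IsSubgroup G L → K ⊆ L →
                      (∀ {y} → y ∈ L → Normalises K y) → (∀ {y} → y ∈ L → y ^ᵍ (p ^ n) ∈ K) →
                      ∃ λ e → ∣ L ∣ ≡ p ^ e * ∣ K ∣
  index-prime-power {K} {L} nil {p} pr K≤ L≤ K⊆L L-norm-K L/K-p = larger-rec Goal climb K (K≤ , id , K⊆L , L-norm-K)
    where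
    Between : Subset n → Set
    Between M = IsSubgroup G M × K ⊆ M × M ⊆ L × (∀ {y} → y ∈ L → Normalises M y)

    Goal : Subset n → Set
    Goal M = Between M → ∃ λ e → ∣ L ∣ ≡ p ^ e * ∣ M ∣

    -- adjoin x ^ p ^ b, where x is central in L modulo M and b is the last exponent with x ^ p ^ b ∉ M
    grow : ∀ {M} → Between M → ¬ L ⊆ M → ∃ λ M′ → Between M′ × ∣ M ∣ < ∣ M′ ∣ × ∣ M′ ∣ ≡ p * ∣ M ∣
    grow {M} (M≤ , K⊆M , M⊆L , L-norm-M) L⊈M with ¬all∈⇒∃ L (_∈? M) L⊈M
    ... | y , y∈L , y∉M with central-modulo nil M≤ L≤ y∈L y∉M
    ...   | x , x∈L , x∉M , x-central
            with crossing (λ b → x ^ᵍ (p ^ b) ∈? M) (x∉M ∘ subst (_∈ M) (^ᵍ-identityʳ x)) n (K⊆M (L/K-p x∈L))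
    ...     | b , x′∉M , x^pᵇ⁺¹∈M =
      adjoin M x′ p
      , (A.subgroup , A.M⊆adjoin ∘ K⊆M , adjoin⊆ L≤ M⊆L x′∈L , adjoin-normalised M≤ L-norm-M x′∈L x′-central)
      , p⊂q⇒∣p∣<∣q∣ (A.M⊆adjoin , x′ , A.x∈adjoin , x′∉M)
      , ∣adjoin∣ pr M≤ x′∉M x′ᵖ∈M p ≤-refl
      where
      x′ = x ^ᵍ (p ^ b)
      x′∈L : x′ ∈ L
      x′∈L = ^ᵍ∈ L≤ x∈L (p ^ b)
      x′-central : ∀ {z} → z ∈ L → commutator G x′ z ∈ M
      x′-central = commutator-^ᵍ∈ M≤ L-norm-M x∈L x-central (p ^ b)
      x′ᵖ∈M : x′ ^ᵍ p ∈ M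
      x′ᵖ∈M = subst (_∈ M) (trans (cong (x ^ᵍ_) (*-comm p (p ^ b))) (^ᵍ-* x (p ^ b) p)) x^pᵇ⁺¹∈M
      module A = Adjoin M≤ (L-norm-M x′∈L) (<-trans z<s (prime>1 pr)) x′ᵖ∈M

    climb : ∀ M → (∀ {M′} → ∣ M ∣ < ∣ M′ ∣ → Goal M′) → Goal M
    climb M rec M-between@(_ , _ , M⊆L , _) with all∈? L (_∈? M)
    ... | yes L⊆M = 0 , trans (≤-antisym (p⊆q⇒∣p∣≤∣q∣ L⊆M) (p⊆q⇒∣p∣≤∣q∣ M⊆L)) (sym (+-identityʳ _))
    ... | no L⊈M =
      let M′ , M′-between , ∣M∣<∣M′∣ , ∣M′∣≡p∣M∣ = grow M-between L⊈M
          e , ∣L∣≡pᵉ∣M′∣ = rec ∣M∣<∣M′∣ M′-between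
      in suc e , (begin
        ∣ L ∣                  ≡⟨ ∣L∣≡pᵉ∣M′∣ ⟩
        p ^ e * ∣ M′ ∣         ≡⟨ cong (p ^ e *_) ∣M′∣≡p∣M∣ ⟩
        p ^ e * (p * ∣ M ∣)    ≡⟨ *-assoc (p ^ e) p ∣ M ∣ ⟨
        p ^ e * p * ∣ M ∣      ≡⟨ cong (_* ∣ M ∣) (*-comm (p ^ e) p) ⟩
        p ^ suc e * ∣ M ∣      ∎)
      where open ≡-Reasoning

  -- The series from H to its normal closure

  module NormalClosureSeries (nil : Nilpotent G) {H : Subset n} (H≤ : IsSubgroup G H) where
    Conjugate⊆ : Fin n → Subset n → Set
    Conjugate⊆ z K = ∀ {h} → h ∈ H → conj G z h ∈ K

    Conjugate⊆? : ∀ z K → Dec (Conjugate⊆ z K)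
    Conjugate⊆? z K = all∈? H (λ h → conj G z h ∈? K)

    PrimePowerElement : Fin n → Set
    PrimePowerElement x = ∃ λ q → Prime q × PElement q x

    record Stage (K : Subset n) : Set where
      field
        subgroup : IsSubgroup G K
        H⊆K : H ⊆ K
        conjugators : List (∃ PrimePowerElement)
        conjugates⊆K : All (λ x → Conjugate⊆ (proj₁ x) K) conjugators
        generated : IsSubgroup G L → H ⊆ L → All (λ x → Conjugate⊆ (proj₁ x) L) conjugators → K ⊆ L

    record Extension (K : Subset n) : Set where
      field
        z : Fin n
        q : ℕ
        q-prime : Prime q
        z-q : PElement q z
        conjugates-normalise : ∀ {h} → h ∈ H → Normalises K (conj G z h)
        h₀ : Fin n
        h₀∈H : h₀ ∈ H
        h₀ᶻ∉K : conj G z h₀ ∉ K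

    Step : Subset n → Subset n → Set
    Step K K′ = NormalIn G K K′ × (∃ λ g → QuotientGeneratedByConjugate G H K K′ g) × QuotientPrimePowerOrder G K K′

    module Extend {K} (stage : Stage K) (extension : Extension K) where
      open Stage stage
      open Extension extension

      -- K′ = Hᶻ K, a subgroup because every hᶻ normalises K
      InProduct : Fin n → Set
      InProduct y = ∃ λ h → h ∈ H × (conj G z h) ⁻¹ ∙ y ∈ K

      InProduct? : Decidable InProduct
      InProduct? y = Fin.any? (λ h → h ∈? H ×-dec (conj G z h) ⁻¹ ∙ y ∈? K)

      K′ : Subset n
      K′ = toSubset InProduct?

      split : ∀ {y} → y ∈ K′ → InProduct y
      split = toSubset⁻ InProduct?

      K⊆K′ : K ⊆ K′
      K⊆K′ {k} k∈K = toSubset⁺ InProduct? (ε , ε∈ H≤ , subst (_∈ K) (sym εᶻ⁻¹∙k≡k) k∈K)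
        where
        εᶻ⁻¹∙k≡k : (conj G z ε) ⁻¹ ∙ k ≡ k
        εᶻ⁻¹∙k≡k = trans (cong (λ u → u ⁻¹ ∙ k) (conj-homo-ε z)) (ε⁻¹-identityˡ k)

      K′-subgroup : IsSubgroup G K′
      K′-subgroup = closed⇒subgroup InProduct? (toSubset⁻ InProduct? (K⊆K′ (ε∈ subgroup))) product
        where
        product : ∀ {y₁ y₂} → InProduct y₁ → InProduct y₂ → InProduct (y₁ ∙ y₂)
        product {y₁} {y₂} (h₁ , h₁∈H , m₁) (h₂ , h₂∈H , m₂) = h₁ ∙ h₂ , ∙∈ H≤ h₁∈H h₂∈H , subst (_∈ K) eq
                                                                 (∙∈ subgroup (conjugates-normalise h₂∈H m₁) m₂)
          where
          eq : conj G (conj G z h₂) ((conj G z h₁) ⁻¹ ∙ y₁) ∙ ((conj G z h₂) ⁻¹ ∙ y₂) ≡ (conj G z (h₁ ∙ h₂)) ⁻¹ ∙ (y₁ ∙ y₂)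
          eq = trans (solve (conjₑ x₁ (inv x₀ ⊗ x₂) ⊗ (inv x₁ ⊗ x₃)) (inv (x₀ ⊗ x₁) ⊗ (x₂ ⊗ x₃)) refl
                        (conj G z h₁ ∷ conj G z h₂ ∷ y₁ ∷ y₂ ∷ []))
                     (cong (λ u → u ⁻¹ ∙ (y₁ ∙ y₂)) (sym (conj-homo-∙ z h₁ h₂)))

      Hᶻ⊆K′ : Conjugate⊆ z K′
      Hᶻ⊆K′ {h} h∈H = toSubset⁺ InProduct? (h , h∈H , subst (_∈ K) (sym (inverseˡ _)) (ε∈ subgroup))

      K′-least : IsSubgroup G L → K ⊆ L → Conjugate⊆ z L → K′ ⊆ L
      K′-least {L} L≤ K⊆L Hᶻ⊆L {y} y∈K′ =
        let h , h∈H , m = split y∈K′ in subst (_∈ L) (\\-leftDividesˡ (conj G z h) y) (∙∈ L≤ (Hᶻ⊆L h∈H) (K⊆L m))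

      K′-normalises : ∀ {y} → y ∈ K′ → Normalises K y
      K′-normalises {y} y∈K′ {k} k∈K =
        let h , h∈H , m = split y∈K′
            a = conj G z h
        in subst (_∈ K) (trans (sym (conj-∙ a (a ⁻¹ ∙ y) k)) (cong (λ u → conj G u k) (\\-leftDividesˡ a y)))
                 (conj∈ subgroup m (conjugates-normalise h∈H k∈K))

      -- y = s (h m) with m ∈ K and s = hᶻ h⁻¹ = [h , z] ^ h⁻¹, a q-element normalising K
      K′/K-q : ∀ {y} → y ∈ K′ → y ^ᵍ (q ^ n) ∈ K
      K′/K-q {y} y∈K′ = let h , h∈H , m = split y∈K′ in from-split h∈H m
        where
        from-split : ∀ {h} → h ∈ H → (conj G z h) ⁻¹ ∙ y ∈ K → y ^ᵍ (q ^ n) ∈ K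
        from-split {h} h∈H m = subst (_∈ K) (trans (cong₂ (λ u v → u ⁻¹ ∙ v ^ᵍ (q ^ n)) sᵠⁿ≡ε s∙hm≡y) (ε⁻¹-identityˡ _))
                                 (^ᵍ-∙-modulo subgroup s-normalises (∙∈ subgroup (H⊆K h∈H) m) (q ^ n))
          where
          a = conj G z h
          s = a ∙ h ⁻¹
          s≡ : s ≡ conj G (h ⁻¹) (commutator G h z)
          s≡ = solve (conjₑ x₀ x₁ ⊗ inv x₁) (conjₑ (inv x₁) (commₑ x₁ x₀)) refl (z ∷ h ∷ [])
          sᵠⁿ≡ε : s ^ᵍ (q ^ n) ≡ ε
          sᵠⁿ≡ε = PElement-bound q-prime (subst (PElement q) (sym s≡)
                    (PElement-conj (h ⁻¹) (PElements.PElement-∙ nil q-prime (PElement-conj h (PElement-⁻¹ z-q)) z-q)))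
          s-normalises : Normalises K s
          s-normalises {k} k∈K = subst (_∈ K) (sym (conj-∙ a (h ⁻¹) k))
                                   (conj∈ subgroup (⁻¹∈ subgroup (H⊆K h∈H)) (conjugates-normalise h∈H k∈K))
          s∙hm≡y : s ∙ (h ∙ (a ⁻¹ ∙ y)) ≡ y
          s∙hm≡y = solve ((x₀ ⊗ inv x₁) ⊗ (x₁ ⊗ (inv x₀ ⊗ x₂))) x₂ refl (a ∷ h ∷ y ∷ [])

      step : Step K K′
      step = (subgroup , K′-subgroup , K⊆K′ , λ y∈K′ k∈K → K′-normalises y∈K′ k∈K)
           , (z , K′-subgroup , (λ { (inj₁ k∈K) → K⊆K′ k∈K ; (inj₂ (h , h∈H , refl)) → Hᶻ⊆K′ h∈H })
                , λ L L≤ gens → K′-least L≤ (gens ∘ inj₁) (λ h∈H → gens (inj₂ (_ , h∈H , refl))))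
           , (let e , ∣K′∣≡qᵉ∣K∣ = index-prime-power nil q-prime subgroup K′-subgroup K⊆K′ K′-normalises K′/K-q
              in q , e , q-prime , ∣K′∣≡qᵉ∣K∣)

      ∣K∣<∣K′∣ : ∣ K ∣ < ∣ K′ ∣
      ∣K∣<∣K′∣ = p⊂q⇒∣p∣<∣q∣ (K⊆K′ , conj G z h₀ , Hᶻ⊆K′ h₀∈H , h₀ᶻ∉K)

      stage′ : Stage K′
      stage′ = record
        { subgroup = K′-subgroup
        ; H⊆K = K⊆K′ ∘ H⊆K
        ; conjugators = (z , q , q-prime , z-q) ∷ conjugators
        ; conjugates⊆K = Hᶻ⊆K′ ∷ All.map (λ Hˣ⊆K {h} h∈H → K⊆K′ (Hˣ⊆K h∈H)) conjugates⊆K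
        ; generated = λ { L≤ H⊆L (Hᶻ⊆L ∷ Hˣ⊆L) → K′-least L≤ (generated L≤ H⊆L Hˣ⊆L) Hᶻ⊆L }
        }

    module FindExtension {K} (stage : Stage K) {q g} (q-prime : Prime q) (g-q : PElement q g)
                         (g∈NN : g ∈ normaliser (normaliser K)) (g∉N : g ∉ normaliser K) where
      open Stage stage

      conj-g-normalises : ∀ {y} → y ∈ K → Normalises K (conj G g y)
      conj-g-normalises y∈K =
        toSubset⁻ (Normalises? K) (toSubset⁻ (Normalises? (normaliser K)) g∈NN (⊆normaliser subgroup y∈K))

      -- otherwise g would normalise K, which is generated by H and the Hˣ
      some-Hˣᵍ⊈K : Conjugate⊆ g K → ¬ All (λ x → Conjugate⊆ (proj₁ x ∙ g) K) conjugators
      some-Hˣᵍ⊈K Hᵍ⊆K Hˣᵍ⊆K = g∉N (toSubset⁺ (Normalises? K) (toSubset⁻ conj-g∈K? ∘ K⊆Kᵍ))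
        where
        conj-g∈K? : Decidable (λ y → conj G g y ∈ K)
        conj-g∈K? y = conj G g y ∈? K
        K⊆Kᵍ : K ⊆ toSubset conj-g∈K?
        K⊆Kᵍ = generated
          (closed⇒subgroup conj-g∈K? (subst (_∈ K) (sym (conj-homo-ε g)) (ε∈ subgroup))
             λ {x} {y} gx∈K gy∈K → subst (_∈ K) (sym (conj-homo-∙ g x y)) (∙∈ subgroup gx∈K gy∈K))
          (toSubset⁺ conj-g∈K? ∘ Hᵍ⊆K)
          (All.map (λ {x} Hˣᵍ⊆K′ {h} h∈H → toSubset⁺ conj-g∈K? (subst (_∈ K) (conj-∙ (proj₁ x) g h) (Hˣᵍ⊆K′ h∈H))) Hˣᵍ⊆K)

      -- [h , x] ∈ K is an r-element, hence commutes with g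
      Hˣᵍ⊆K : ∀ {r x} → Prime r → PElement r x → r ≢ q → Conjugate⊆ x K → Conjugate⊆ g K → Conjugate⊆ (x ∙ g) K
      Hˣᵍ⊆K {r} {x} r-prime x-r r≢q Hˣ⊆K Hᵍ⊆K {h} h∈H =
        subst (_∈ K) hˣᵍ≡ (∙∈ subgroup (Hᵍ⊆K h∈H) (subst (_∈ K) (sym commutes) [h,x]∈K))
        where
        [h,x]∈K : commutator G h x ∈ K
        [h,x]∈K = subst (_∈ K) (sym (commutator≡⁻¹∙conj h x)) (∙∈ subgroup (⁻¹∈ subgroup (H⊆K h∈H)) (Hˣ⊆K h∈H))
        commutes : conj G g (commutator G h x) ≡ commutator G h x
        commutes = PElements-commute nil r-prime q-prime r≢q
                     (PElements.PElement-∙ nil r-prime (PElement-conj h (PElement-⁻¹ x-r)) x-r) g-q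
        hˣᵍ≡ : conj G g h ∙ conj G g (commutator G h x) ≡ conj G (x ∙ g) h
        hˣᵍ≡ = trans (sym (conj-homo-∙ g h _)) (trans (cong (conj G g) (sym (conj≡∙commutator x h))) (sym (conj-∙ x g h)))

      extension-from : ∀ {z} → PElement q z → (∀ {h} → h ∈ H → Normalises K (conj G z h)) →
                       ¬ Conjugate⊆ z K → Extension K
      extension-from {z} z-q normalise ¬Hᶻ⊆K =
        let h₀ , h₀∈H , h₀ᶻ∉K = ¬all∈⇒∃ H (λ h → conj G z h ∈? K) ¬Hᶻ⊆K
        in record { z = z ; q = q ; q-prime = q-prime ; z-q = z-q ; conjugates-normalise = normalise
                  ; h₀ = h₀ ; h₀∈H = h₀∈H ; h₀ᶻ∉K = h₀ᶻ∉K }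

      extension-from-conjugator : ∀ (x : ∃ PrimePowerElement) → Conjugate⊆ (proj₁ x) K →
                                  ¬ Conjugate⊆ (proj₁ x ∙ g) K → Conjugate⊆ g K → Extension K
      extension-from-conjugator (x , r , r-prime , x-r) Hˣ⊆K ¬Hˣᵍ⊆K Hᵍ⊆K with r ℕ.≟ q
      ... | yes refl = extension-from (PElements.PElement-∙ nil q-prime x-r g-q)
                         (λ {h} h∈H → subst (Normalises K) (sym (conj-∙ x g h)) (conj-g-normalises (Hˣ⊆K h∈H))) ¬Hˣᵍ⊆K
      ... | no r≢q = ⊥-elim (¬Hˣᵍ⊆K (Hˣᵍ⊆K r-prime x-r r≢q Hˣ⊆K Hᵍ⊆K))

      extension : Extension K
      extension with Conjugate⊆? g K
      ... | no ¬Hᵍ⊆K = extension-from g-q (conj-g-normalises ∘ H⊆K) ¬Hᵍ⊆K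
      ... | yes Hᵍ⊆K =
        let bad = ¬All⇒Any¬ (λ x → Conjugate⊆? (proj₁ x ∙ g) K) conjugators (some-Hˣᵍ⊈K Hᵍ⊆K)
            Hˣ⊆K , ¬Hˣᵍ⊆K = All.lookupAny conjugates⊆K bad
        in extension-from-conjugator (Any.lookup bad) Hˣ⊆K ¬Hˣᵍ⊆K Hᵍ⊆K

    -- from a prime-power element g ∈ N(N(K)) ∖ N(K), given by the normaliser condition
    extension : ∀ {K} → Stage K → ¬ (∀ g → Normalises K g) → Extension K
    extension {K} stage ¬normal =
      let g₀ , ¬g₀-normalises = Fin.¬∀⟶∃¬ n (Normalises K) (Normalises? K) ¬normal
          x , x∉N , x∈NN = normaliser-condition nil (normaliser-subgroup K) (¬g₀-normalises ∘ toSubset⁻ (Normalises? K))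
          q , g , q-prime , g-q , g∈NN , g∉N =
            prime-power-element-outside (normaliser-subgroup K) (normaliser-subgroup (normaliser K)) x∈NN x∉N
      in FindExtension.extension stage q-prime g-q g∈NN g∉N

    closure : ∀ {K} → Stage K → (∀ g → Normalises K g) → IsNormalClosure G H K
    closure stage normal = subgroup , (λ { (g , h , h∈H , refl) → normal g (H⊆K h∈H) })
                         , λ L L≤ Hᴳ⊆L → generated L≤ (λ {h} h∈H → subst (_∈ L) (conj-ε h) (Hᴳ⊆L (ε , h , h∈H , refl)))
                                                    (All.map (λ {x} _ {h} h∈H → Hᴳ⊆L (proj₁ x , h , h∈H , refl)) conjugates⊆K)
      where open Stage stage

    Series : Subset n → Set
    Series K = ∃₂ λ (m : ℕ) (S : ℕ → Subset n) → S 0 ≡ K × IsNormalClosure G H (S m) × (∀ k → k < m → Step (S k) (S (suc k)))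

    _◁∷_ : ∀ {K K′} → Step K K′ → Series K′ → Series K
    _◁∷_ {K} step (m , S , refl , closed , steps) =
      suc m , (λ { zero → K ; (suc i) → S i }) , refl , closed , λ { zero _ → step ; (suc k) (s≤s k<m) → steps k k<m }

    series : ∀ K → Stage K → Series K
    series = larger-rec (λ K → Stage K → Series K) build
      where
      build : ∀ K → (∀ {K′} → ∣ K ∣ < ∣ K′ ∣ → Stage K′ → Series K′) → Stage K → Series K
      build K rec stage with Fin.all? (Normalises? K)
      ... | yes normal = 0 , (λ _ → K) , refl , closure stage normal , λ _ ()
      ... | no ¬normal = E.step ◁∷ rec E.∣K∣<∣K′∣ E.stage′
        where module E = Extend stage (extension stage ¬normal)

    initial : Stage H
    initial = record { subgroup = H≤ ; H⊆K = id ; conjugators = [] ; conjugates⊆K = [] ; generated = λ _ H⊆L _ → H⊆L }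

lemma2p5 : ∀ {n} (G : FinGroup n) → Nilpotent G → (H : Subset n) → IsSubgroup G H →
    ∃₂ λ (m : ℕ) (S : ℕ → Subset n) →
      S 0 ≡ H × IsNormalClosure G H (S m) ×
      (∀ k → k < m →
        NormalIn G (S k) (S (suc k)) ×
        (∃ λ (g : Fin n) → QuotientGeneratedByConjugate G H (S k) (S (suc k)) g) ×
        QuotientPrimePowerOrder G (S k) (S (suc k)))
lemma2p5 G nil H H≤ = series H initial
  where open NormalClosureSeries G nil H≤
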